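{- Let $n\geq3$ and $k\geq3$, and let $[a_0,a_1,\dots,a_{n-1}]$ be a circuit in $B_k(n-1)$ containing two negasymmetric $n$-tuples at distance $t$ apart, where $0<t\leq n/2$ (that is, for some $s$, both $(a_{\overline{s}},a_{\overline{s+1}},\dots,a_{\overline{s+n-1}})$ and $(a_{\overline{s+t}},a_{\overline{s+t+1}},\dots,a_{\overline{s+t+n-1}})$ are negasymmetric, where $\overline{x}=x\bmod n$). Then $[a_0,a_1,\dots,a_{n-1}]$ has period dividing $2t$.
   Context: Tuples are $k$-ary (entries in $\mathbb{Z}_k$), negation is modulo $k$, $\mathbf{u}^R$ is the reverse of $\mathbf{u}$; a tuple $\mathbf{u}$ is negasymmetric if $\mathbf{u}=-\mathbf{u}^R$. $B_k(n-1)$ is the de Bruijn digraph with vertices the $k$-ary $(n-1)$-tuples and edges the $k$-ary $n$-tuples $(a_0,\dots,a_{n-1})$ from $(a_0,\dots,a_{n-2})$ to $(a_1,\dots,a_{n-1})$. For an $n$-tuple $(a_0,\dots,a_{n-1})$, with $p$ the least positive $c$ such that $a_i=a_{(i+c)\bmod n}$ for all $i$, $[a_0,\dots,a_{n-1}]$ is the circuit whose edges (the $n$-tuples it contains) are the $p$ cyclic shifts $(a_j,\dots,a_{j+n-1})$ (indices mod $n$), $0\le j<p$; $p$ is its period. -}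

module Defs where

open import Data.Nat using (ℕ; zero; suc; _+_; _∸_; _<_; NonZero)
open import Data.Nat.DivMod using (_%_; m%n<n)
open import Data.Fin using (Fin; toℕ; fromℕ<; opposite)
open import Data.Fin.Properties using ()
open import Data.Product using (_×_)
open import Data.Empty using (⊥)
open import Relation.Binary.PropositionalEquality using (_≡_)

negₖ : ∀ {k} .{{_ : NonZero k}} → Fin k → Fin k
negₖ {k} x = fromℕ< (m%n<n (k ∸ toℕ x) k)

cyc : ∀ {n k} .{{_ : NonZero n}} → (Fin n → Fin k) → ℕ → Fin k
cyc {n} a x = a (fromℕ< (m%n<n x n))

shiftTuple : ∀ {n k} .{{_ : NonZero n}} → (Fin n → Fin k) → ℕ → (Fin n → Fin k)
shiftTuple a s i = cyc a (s + toℕ i)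

rev : ∀ {n k} → (Fin n → Fin k) → (Fin n → Fin k)
rev u i = u (opposite i)

Negasymmetric : ∀ {n k} .{{_ : NonZero k}} → (Fin n → Fin k) → Set
Negasymmetric u = ∀ i → u i ≡ negₖ (rev u i)

ShiftInvariant : ∀ {n k} .{{_ : NonZero n}} → (Fin n → Fin k) → ℕ → Set
ShiftInvariant {n} a c = ∀ (i : Fin n) → a i ≡ cyc a (toℕ i + c)


IsPeriod : ∀ {n k} .{{_ : NonZero n}} → (Fin n → Fin k) → ℕ → Set
IsPeriod a p = (0 < p) × ShiftInvariant a p × (∀ c → 0 < c → c < p → ¬ShiftInv c)
  where
  ¬ShiftInv : ℕ → Set
  ¬ShiftInv c = ShiftInvariant a c → ⊥

-- The cyclic sequence x ↦ a_(x mod n) is negated by the reflection x ↦ 2s − 1 − x, since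
-- the tuple starting at s is negasymmetric, and likewise by x ↦ 2(s + t) − 1 − x. Composing
-- the two reflections gives the translation x ↦ x + 2t, so 2t is a shift-invariance of the
-- circuit, and the least positive shift-invariance divides every other one.
module Submission where

open import Defs
open import Data.Nat using (ℕ; zero; suc; pred; _+_; _*_; _∸_; _≤_; _<_; s≤s; z<s; NonZero; >-nonZero)
open import Data.Nat.Properties
open import Data.Nat.DivMod using (_%_; _/_; m%n<n; m<n⇒m%n≡m; m≡m%n+[m/n]*n; [m+n]%n≡m%n)
open import Data.Nat.Divisibility using (_∣_; divides; ∣m+n∣m⇒∣n; n∣m*n; m%n≡0⇒n∣m)
open import Data.Nat.Tactic.RingSolver using (solve-∀)
open import Data.Fin using (Fin; toℕ; fromℕ<; opposite)
open import Data.Fin.Properties using (toℕ-fromℕ<; fromℕ<-toℕ; fromℕ<-cong; opposite-prop; toℕ<n)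
open import Data.Product using (_,_)
open import Relation.Nullary using (¬_; contradiction)
open import Relation.Binary.PropositionalEquality
open ≡-Reasoning

d∣1+m∧1+m<d+d⇒1+m≡d : ∀ {d m} → d ∣ suc m → suc m < d + d → suc m ≡ d
d∣1+m∧1+m<d+d⇒1+m≡d (divides zero ()) _
d∣1+m∧1+m<d+d⇒1+m≡d {d} (divides 1 eq) _ = trans eq (+-identityʳ d)
d∣1+m∧1+m<d+d⇒1+m≡d {d} (divides (suc (suc q)) eq) 1+m<d+d =
  contradiction (subst (_< d + d) eq 1+m<d+d) (≤⇒≯ (+-monoʳ-≤ d (m≤m+n d (q * d))))

1+[m%d+n%d]≡d : ∀ m n d .{{_ : NonZero d}} → d ∣ suc (m + n) → suc (m % d + n % d) ≡ d
1+[m%d+n%d]≡d m n d d∣1+m+n = d∣1+m∧1+m<d+d⇒1+m≡d d∣1+m%d+n%d 1+m%d+n%d<d+d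
  where
  split : ∀ r q r′ q′ d → suc (r + q * d + (r′ + q′ * d)) ≡ (q + q′) * d + suc (r + r′)
  split = solve-∀

  d∣1+m%d+n%d : d ∣ suc (m % d + n % d)
  d∣1+m%d+n%d = ∣m+n∣m⇒∣n (subst (d ∣_) eq d∣1+m+n) (n∣m*n (m / d + n / d))
    where
    eq : suc (m + n) ≡ (m / d + n / d) * d + suc (m % d + n % d)
    eq = trans (cong₂ (λ u v → suc (u + v)) (m≡m%n+[m/n]*n m d) (m≡m%n+[m/n]*n n d))
               (split (m % d) (m / d) (n % d) (n / d) d)

  1+m%d+n%d<d+d : suc (m % d + n % d) < d + d
  1+m%d+n%d<d+d = subst (_< d + d) (+-suc (m % d) (n % d)) (+-mono-<-≤ (m%n<n m d) (m%n<n n d))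

module _ {A : Set} (f : ℕ → A) where

  TranslationInvariant : ℕ → Set
  TranslationInvariant c = ∀ y → f (y + c) ≡ f y

  invariant-* : ∀ {c} → TranslationInvariant c → ∀ q → TranslationInvariant (q * c)
  invariant-* inv zero y = cong f (+-identityʳ y)
  invariant-* {c} inv (suc q) y = begin
    f (y + (c + q * c)) ≡⟨ cong f (+-assoc y c (q * c)) ⟨
    f (y + c + q * c)   ≡⟨ invariant-* inv q (y + c) ⟩
    f (y + c)           ≡⟨ inv y ⟩
    f y                 ∎

  invariant-% : ∀ {p T} .{{_ : NonZero p}} →
                TranslationInvariant p → TranslationInvariant T → TranslationInvariant (T % p)
  invariant-% {p} {T} invp invT y = begin
    f (y + T % p)               ≡⟨ invariant-* invp (T / p) (y + T % p) ⟨
    f (y + T % p + T / p * p)   ≡⟨ cong f (+-assoc y (T % p) (T / p * p)) ⟩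
    f (y + (T % p + T / p * p)) ≡⟨ cong (λ z → f (y + z)) (m≡m%n+[m/n]*n T p) ⟨
    f (y + T)                   ≡⟨ invT y ⟩
    f y                         ∎

  least-invariant-∣ : ∀ {p T} .{{_ : NonZero p}} → TranslationInvariant p →
                      (∀ c → 0 < c → c < p → ¬ TranslationInvariant c) →
                      TranslationInvariant T → p ∣ T
  least-invariant-∣ {p} {T} invp least invT with T % p in T%p≡r
  ... | zero  = m%n≡0⇒n∣m T p T%p≡r
  ... | suc r = contradiction (subst TranslationInvariant T%p≡r (invariant-% invp invT))
                  (least (suc r) z<s (subst (_< p) T%p≡r (m%n<n T p)))

module _ {n k : ℕ} .{{_ : NonZero n}} (a : Fin n → Fin k) where

  cyc-invariant-n : TranslationInvariant (cyc a) n
  cyc-invariant-n y = cong a (fromℕ<-cong _ _ ([m+n]%n≡m%n y n) _ _)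

  cyc-periodic : ∀ q → TranslationInvariant (cyc a) (q * n)
  cyc-periodic = invariant-* (cyc a) cyc-invariant-n

  cyc-+-% : ∀ x y → cyc a (x + y % n) ≡ cyc a (x + y)
  cyc-+-% x y = begin
    cyc a (x + y % n)               ≡⟨ cyc-periodic (y / n) (x + y % n) ⟨
    cyc a (x + y % n + y / n * n)   ≡⟨ cong (cyc a) (+-assoc x (y % n) (y / n * n)) ⟩
    cyc a (x + (y % n + y / n * n)) ≡⟨ cong (λ z → cyc a (x + z)) (m≡m%n+[m/n]*n y n) ⟨
    cyc a (x + y)                   ∎

  shiftInvariant⇒translationInvariant : ∀ {c} → ShiftInvariant a c → TranslationInvariant (cyc a) c
  shiftInvariant⇒translationInvariant {c} si y = begin
    cyc a (y + c)     ≡⟨ cong (cyc a) (+-comm y c) ⟩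
    cyc a (c + y)     ≡⟨ cyc-+-% c y ⟨
    cyc a (c + y % n) ≡⟨ cong (cyc a) (+-comm c (y % n)) ⟩
    cyc a (y % n + c) ≡⟨ cong (λ z → cyc a (z + c)) (toℕ-fromℕ< y%n<n) ⟨
    cyc a (toℕ (fromℕ< y%n<n) + c) ≡⟨ si (fromℕ< y%n<n) ⟨
    cyc a y           ∎
    where
    y%n<n : y % n < n
    y%n<n = m%n<n y n

  translationInvariant⇒shiftInvariant : ∀ {c} → TranslationInvariant (cyc a) c → ShiftInvariant a c
  translationInvariant⇒shiftInvariant {c} inv i = begin
    a i               ≡⟨ cong a (trans (fromℕ<-cong _ _ (m<n⇒m%n≡m (toℕ<n i)) _ _) (fromℕ<-toℕ i (toℕ<n i))) ⟨
    cyc a (toℕ i)     ≡⟨ inv (toℕ i) ⟨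
    cyc a (toℕ i + c) ∎

  period-∣ : ∀ {p T} → IsPeriod a p → ShiftInvariant a T → p ∣ T
  period-∣ (0<p , sip , least) siT =
    least-invariant-∣ (cyc a) {{>-nonZero 0<p}} (shiftInvariant⇒translationInvariant sip)
      (λ c 0<c c<p inv → least c 0<c c<p (translationInvariant⇒shiftInvariant inv))
      (shiftInvariant⇒translationInvariant siT)

module _ {n k : ℕ} .{{_ : NonZero n}} .{{_ : NonZero k}} (a : Fin n → Fin k) where

  -- The reflection x ↦ 2s − 1 − x (mod n) negates the cyclic sequence.
  NegasymmetricAbout : ℕ → Set
  NegasymmetricAbout s = ∀ x y → n ∣ suc (x + y) → cyc a (s + x) ≡ negₖ (cyc a (s + y))

  negasymmetric-opposite : ∀ {s} → Negasymmetric (shiftTuple a s) →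
                           ∀ x y → suc (x + y) ≡ n → cyc a (s + x) ≡ negₖ (cyc a (s + y))
  negasymmetric-opposite {s} neg x y 1+x+y≡n = begin
    cyc a (s + x)                       ≡⟨ cong (λ z → cyc a (s + z)) (toℕ-fromℕ< x<n) ⟨
    cyc a (s + toℕ i)                   ≡⟨ neg i ⟩
    negₖ (cyc a (s + toℕ (opposite i))) ≡⟨ cong (λ z → negₖ (cyc a (s + z))) toℕ-opposite ⟩
    negₖ (cyc a (s + y))                ∎
    where
    x<n : x < n
    x<n = subst (x <_) 1+x+y≡n (s≤s (m≤m+n x y))

    i : Fin n
    i = fromℕ< x<n

    toℕ-opposite : toℕ (opposite i) ≡ y
    toℕ-opposite = begin
      toℕ (opposite i)     ≡⟨ opposite-prop i ⟩
      n ∸ suc (toℕ i)      ≡⟨ cong (λ z → n ∸ suc z) (toℕ-fromℕ< x<n) ⟩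
      n ∸ suc x            ≡⟨ cong (_∸ suc x) 1+x+y≡n ⟨
      suc (x + y) ∸ suc x  ≡⟨ m+n∸m≡n x y ⟩
      y                    ∎

  negasymmetric⇒negasymmetricAbout : ∀ {s} → Negasymmetric (shiftTuple a s) → NegasymmetricAbout s
  negasymmetric⇒negasymmetricAbout {s} neg x y n∣1+x+y = begin
    cyc a (s + x)            ≡⟨ cyc-+-% a s x ⟨
    cyc a (s + x % n)        ≡⟨ negasymmetric-opposite neg (x % n) (y % n) (1+[m%d+n%d]≡d x y n n∣1+x+y) ⟩
    negₖ (cyc a (s + y % n)) ≡⟨ cong negₖ (cyc-+-% a s y) ⟩
    negₖ (cyc a (s + y))     ∎

  -- y and y + 2t are mirrored, about s and about s + t respectively, onto the same point s + t + j.
  negasymmetricAbout-invariant-2* : ∀ {s t} → NegasymmetricAbout s → NegasymmetricAbout (s + t) →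
                                    TranslationInvariant (cyc a) (2 * t)
  negasymmetricAbout-invariant-2* {s} {t} about-s about-s+t y = begin
    cyc a (y + 2 * t)          ≡⟨ cyc-periodic a s (y + 2 * t) ⟨
    cyc a (y + 2 * t + s * n)  ≡⟨ cong (cyc a) y+2t+sn≡s+t+[i+t] ⟩
    cyc a (s + t + (i + t))    ≡⟨ about-s+t (i + t) j n∣1+[i+t]+j ⟩
    negₖ (cyc a (s + t + j))   ≡⟨ cong (λ z → negₖ (cyc a z)) (+-assoc s t j) ⟩
    negₖ (cyc a (s + (t + j))) ≡⟨ about-s i (t + j) (subst (λ z → n ∣ suc z) (+-assoc i t j) n∣1+[i+t]+j) ⟨
    cyc a (s + i)              ≡⟨ cong (cyc a) s+i≡y+sn ⟩
    cyc a (y + s * n)          ≡⟨ cyc-periodic a s y ⟩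
    cyc a y                    ∎
    where
    m : ℕ
    m = pred n

    1+m≡n : suc m ≡ n
    1+m≡n = suc-pred n

    i j : ℕ
    i = y + s * m
    j = m * suc (i + t)

    y+2t+sn≡s+t+[i+t] : y + 2 * t + s * n ≡ s + t + (i + t)
    y+2t+sn≡s+t+[i+t] = trans (cong (λ z → y + 2 * t + s * z) (sym 1+m≡n)) (identity y t s m)
      where
      identity : ∀ y t s m → y + 2 * t + s * suc m ≡ s + t + (y + s * m + t)
      identity = solve-∀

    s+i≡y+sn : s + i ≡ y + s * n
    s+i≡y+sn = trans (identity y s m) (cong (λ z → y + s * z) 1+m≡n)
      where
      identity : ∀ y s m → s + (y + s * m) ≡ y + s * suc m
      identity = solve-∀

    n∣1+[i+t]+j : n ∣ suc (i + t + j)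
    n∣1+[i+t]+j = divides (suc (i + t)) (trans (identity (i + t) m) (cong (suc (i + t) *_) 1+m≡n))
      where
      identity : ∀ u m → suc (u + m * suc u) ≡ suc u * suc m
      identity = solve-∀

lemma2p7 : (n k : ℕ) → 3 ≤ n → 3 ≤ k → .{{_ : NonZero n}} → .{{_ : NonZero k}} →
    (a : Fin n → Fin k) → (s t : ℕ) → 0 < t → 2 * t ≤ n →
    Negasymmetric (shiftTuple a s) → Negasymmetric (shiftTuple a (s + t)) →
    (p : ℕ) → IsPeriod a p → p ∣ 2 * t
lemma2p7 n k _ _ a s t _ _ neg₁ neg₂ p period =
  period-∣ a period (translationInvariant⇒shiftInvariant a
    (negasymmetricAbout-invariant-2* a (negasymmetric⇒negasymmetricAbout a neg₁)
                                       (negasymmetric⇒negasymmetricAbout a neg₂)))
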